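{- For a crucial instance of \textsc{Best Response}, the picking strategy (equivalently, allocation sequence) produced by GreedyAlg is an optimal solution.
   Context: Sequential allocation: a set $O$ of $m$ items is allocated to agents $N=\{1,\dots,n\}$ according to a policy $\pi$ (sequence of agents of length $m$). Each agent $i$ has a strict ranking $\succ_i$ of $O$; agent 1 is the manipulator with additive utility $u$ consistent with $\succ_1$. Non-manipulators take their most preferred remaining item at their turns; the manipulator follows a picking strategy (a permutation of $O$), taking the first remaining item in it at each of its turns. \textsc{Best Response} asks for a picking strategy maximizing the manipulator's total utility. The core of a policy is the sequence obtained by deleting all occurrences of agent 1; the manipulator position vector is $(z_1<\dots<z_{k_1})$ of positions of agent 1. Policy $\pi$ dominates $\pi'$ if they have the same length and core and $z_i\le z'_i$ for all $i$. An instance with policy $\pi$ is crucial if for every policy $\pi'\neq\pi$ dominated by $\pi$, the optimal utility of the instance with policy $\pi'$ (all else equal) is strictly worse than that of the instance with policy $\pi$. GreedyAlg: process the positions of $\pi$ in order. At a non-manipulator's position, it takes its most preferred remaining item. At a manipulator position $i$, let $\pi_{ -1}$ be the core of the remaining policy (positions $i,\dots,m$); if $\pi_{ -1}$ is empty, the manipulator is assigned its best remaining item under $\succ_1$; otherwise it is assigned the most preferred remaining item of the first agent of $\pi_{ -1}$. The item assigned at the manipulator's $t$th turn is the $t$th item of the manipulator's picking strategy (remaining items appended in any order). -}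

module Defs where

open import Data.Nat using (ℕ; zero; suc; _≤_; _<_)
open import Data.Fin using (Fin; zero; suc; _≟_)
open import Data.Bool using (Bool; true; false; if_then_else_)
open import Data.Maybe using (Maybe; just; nothing)
open import Data.List using (List; []; _∷_; _++_; length; lookup; allFin)
open import Data.Bool.ListAction using (any)
open import Data.List.Relation.Binary.Permutation.Propositional using (_↭_)
open import Data.List.Relation.Binary.Pointwise using (Pointwise)
open import Data.Vec using (Vec; toList)
open import Data.Product using (Σ; _×_; ∃)
open import Relation.Nullary using (¬_)
open import Relation.Nullary.Decidable using (⌊_⌋)
open import Relation.Binary.PropositionalEquality using (_≡_)
open import Data.Rational using (ℚ; 0ℚ; _+_) renaming (_<_ to _<ℚ_; _≤_ to _≤ℚ_)

-- Items are Fin m.  Agents are Fin (suc k) (n = suc k agents);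
-- the manipulator (agent 1 of the paper) is  zero.
Agent : ℕ → Set
Agent k = Fin (suc k)

-- A strict ranking of the items is a list of all items, most preferred first.
IsRanking : ∀ {m} → List (Fin m) → Set
IsRanking {m} r = r ↭ allFin m

Prefers : ∀ {m} → List (Fin m) → Fin m → Fin m → Set
Prefers r a b = Σ (Fin (length r)) λ i → Σ (Fin (length r)) λ j →
  (Data.Fin._<_ i j) × (lookup r i ≡ a) × (lookup r j ≡ b)

Consistent : ∀ {m} → List (Fin m) → (Fin m → ℚ) → Set
Consistent r u = ∀ a b → Prefers r a b → u b <ℚ u a

mem : ∀ {m} → Fin m → List (Fin m) → Bool
mem x taken = any (λ y → ⌊ x ≟ y ⌋) taken

firstAvail : ∀ {m} → List (Fin m) → List (Fin m) → Maybe (Fin m)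
firstAvail [] taken = nothing
firstAvail (x ∷ xs) taken = if mem x taken then firstAvail xs taken else just x

IsStrategy : ∀ {m} → List (Fin m) → Set
IsStrategy {m} s = s ↭ allFin m

run : ∀ {k m} → (Agent k → List (Fin m)) → List (Fin m) → List (Agent k) →
      List (Fin m) → List (Fin m)
run rk s [] taken = []
run rk s (zero ∷ π) taken with firstAvail s taken
... | nothing = run rk s π taken
... | just x  = x ∷ run rk s π (x ∷ taken)
run rk s (suc a ∷ π) taken with firstAvail (rk (suc a)) taken
... | nothing = run rk s π taken
... | just x  = run rk s π (x ∷ taken)

sumU : ∀ {m} → (Fin m → ℚ) → List (Fin m) → ℚ
sumU u [] = 0ℚ
sumU u (x ∷ xs) = u x + sumU u xs

utility : ∀ {k m} → (Agent k → List (Fin m)) → (Fin m → ℚ) →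
          Vec (Agent k) m → List (Fin m) → ℚ
utility rk u π s = sumU u (run rk s (toList π) [])

Optimal : ∀ {k m} → (Agent k → List (Fin m)) → (Fin m → ℚ) →
          Vec (Agent k) m → List (Fin m) → Set
Optimal {m = m} rk u π s =
  IsStrategy s × (∀ (s' : List (Fin m)) → IsStrategy s' → utility rk u π s' ≤ℚ utility rk u π s)

core : ∀ {k} → List (Agent k) → List (Agent k)
core [] = []
core (zero ∷ π) = core π
core (suc a ∷ π) = suc a ∷ core π

positionsFrom : ∀ {k} → ℕ → List (Agent k) → List ℕ
positionsFrom n [] = []
positionsFrom n (zero ∷ π) = n ∷ positionsFrom (suc n) π
positionsFrom n (suc a ∷ π) = positionsFrom (suc n) π

positions : ∀ {k} → List (Agent k) → List ℕ
positions π = positionsFrom 0 π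

-- π dominates π' (same length is enforced by the type Vec _ m)
Dominates : ∀ {k m} → Vec (Agent k) m → Vec (Agent k) m → Set
Dominates π π' = (core (toList π) ≡ core (toList π')) ×
  Pointwise _≤_ (positions (toList π)) (positions (toList π'))

-- crucial instance: every policy π' ≠ π dominated by π has strictly smaller
-- optimal utility, i.e. every strategy under π' is strictly beaten by some
-- strategy under π.
Crucial : ∀ {k m} → (Agent k → List (Fin m)) → (Fin m → ℚ) → Vec (Agent k) m → Set
Crucial {k} {m} rk u π = ∀ (π' : Vec (Agent k) m) → ¬ (π' ≡ π) → Dominates π π' →
  ∀ (s' : List (Fin m)) → IsStrategy s' →
  ∃ λ (s : List (Fin m)) → IsStrategy s × (utility rk u π' s' <ℚ utility rk u π s)

greedyFrom : ∀ {k m} → (Agent k → List (Fin m)) → List (Agent k) →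
             List (Fin m) → List (Fin m)
greedyFrom rk [] taken = []
greedyFrom rk (zero ∷ π) taken with core π | firstAvail (rk zero) taken
... | [] | nothing = greedyFrom rk π taken
... | [] | just x = x ∷ greedyFrom rk π (x ∷ taken)
... | (a ∷ _) | _ with firstAvail (rk a) taken
...   | nothing = greedyFrom rk π taken
...   | just x = x ∷ greedyFrom rk π (x ∷ taken)
greedyFrom rk (suc a ∷ π) taken with firstAvail (rk (suc a)) taken
... | nothing = greedyFrom rk π taken
... | just x = greedyFrom rk π (x ∷ taken)

greedyPicks : ∀ {k m} → (Agent k → List (Fin m)) → Vec (Agent k) m → List (Fin m)
greedyPicks rk π = greedyFrom rk (toList π) []

module Submission where

-- Start from an optimal picking strategy, which exists because there are only finitely many,
-- and walk along the policy, rewriting it turn by turn into an optimal strategy that begins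
-- with GreedyAlg's picks.  At a manipulator turn GreedyAlg claims the item x that the next
-- other agent a would take (the manipulator's own favourite if nobody else moves again);
-- move x to the front of the strategy.  If no other agent moves again, x is the best item
-- left, so this cannot lose.  Otherwise, if the manipulator obtains x anyway before a moves,
-- the exchange only reorders its picks.  If it does not, a takes x, so letting a move just
-- before that manipulator turn changes nothing; the swapped policy is dominated by π, yet
-- the optimal strategy does equally well under it, contradicting cruciality.  Once a strategy
-- begins with the greedy picks its remaining entries are never consulted, so every such
-- strategy is optimal.

open import Defs
open import Algebra.Bundles using (CommutativeMonoid)
import Algebra.Properties.CommutativeSemigroup as CommSemigroupProperties
open import Data.Bool using (true; false; _∨_)
open import Data.Bool.Properties using (∨-zeroʳ; ∨-commutativeMonoid)
open import Data.Fin using (Fin; zero; suc; _≟_)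
open import Data.List using (List; []; _∷_; _++_; [_]; length; replicate; allFin; filter; cartesianProductWith)
open import Data.List.Properties using (++-assoc; ++-identityʳ; ++-cancelˡ; ∷-injectiveˡ; length-tabulate)
open import Data.List.Membership.Propositional using (_∈_; _∉_)
open import Data.List.Membership.Propositional.Properties
  using (∈-allFin; ∈-∃++; ∈-++⁻; ∈-++⁺ʳ; ∈-filter⁺; ∈-cartesianProductWith⁺)
open import Data.List.Relation.Binary.Permutation.Propositional
  using (_↭_; prep; swap; ↭-refl; ↭-reflexive; ↭-sym; ↭-trans; module PermutationReasoning)
import Data.List.Relation.Binary.Permutation.Propositional as ↭
open import Data.List.Relation.Binary.Permutation.Propositional.Properties
  using (↭-length; ++⁺ˡ; shift; ∈-resp-↭; ↭-empty-inv; drop-mid)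
open import Data.List.Relation.Binary.Pointwise using (Pointwise; _∷_)
import Data.List.Relation.Binary.Pointwise as Pointwise
import Data.List.Relation.Unary.All as All
open import Data.List.Relation.Unary.All.Properties using (all-filter)
open import Data.List.Relation.Unary.Any using (here; there; index)
open import Data.List.Relation.Unary.Any.Properties using (lookup-index)
open import Data.Maybe using (just; nothing)
open import Data.Nat using (ℕ; suc; zero; z≤n; s≤s) renaming (_≤_ to _≤ℕ_)
open import Data.Nat.Properties using (n≤1+n) renaming (≤-refl to ≤ℕ-refl)
open import Data.Product using (∃; Σ; _×_; _,_; proj₁; proj₂)
open import Data.Rational using (ℚ; 0ℚ; _+_) renaming (_<_ to _<ℚ_; _≤_ to _≤ℚ_)
import Data.Rational.Properties as ℚ
open import Data.Sum using (inj₁; inj₂)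
open import Data.Vec using (Vec; toList; fromList)
open import Data.Vec.Properties using (toList∘fromList; length-toList)
open import Function using (id; case_of_)
open import Relation.Binary.Bundles using (DecTotalOrder)
open import Relation.Binary.PropositionalEquality hiding ([_])
open import Relation.Nullary using (Dec; yes; no; contradiction)
open import Relation.Nullary.Decidable using (⌊_⌋)
open import Data.List.Extrema (DecTotalOrder.totalOrder ℚ.≤-decTotalOrder)
  using (argmax; argmax-all; f[xs]≤f[argmax])

vectorOf : ∀ {A : Set} {n} (l : List A) → length l ≡ n → Σ (Vec A n) λ v → toList v ≡ l
vectorOf l refl = fromList l , toList∘fromList l

advance : ∀ {A : Set} {l pre suf : List A} {b} → l ≡ pre ++ b ∷ suf → l ≡ (pre ++ [ b ]) ++ suf
advance {pre = pre} {suf} {b} eq = trans eq (sym (++-assoc pre [ b ] suf))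

module ∨-Props = CommSemigroupProperties (CommutativeMonoid.commutativeSemigroup ∨-commutativeMonoid)
module +-Props = CommSemigroupProperties (CommutativeMonoid.commutativeSemigroup ℚ.+-0-commutativeMonoid)

module _ {m : ℕ} where

  -- A record rather than a function type, so that S and S' can be inferred.
  record SameTaken (S S' : List (Fin m)) : Set where
    constructor sameTaken
    field mem-≡ : ∀ z → mem z S ≡ mem z S'
  open SameTaken

  sameTaken-∷ : ∀ y {S S'} → SameTaken S S' → SameTaken (y ∷ S) (y ∷ S')
  sameTaken-∷ y eq = sameTaken λ z → cong (⌊ z ≟ y ⌋ ∨_) (mem-≡ eq z)

  sameTaken-swap : ∀ x y S → SameTaken (x ∷ y ∷ S) (y ∷ x ∷ S)
  sameTaken-swap x y S = sameTaken λ z → ∨-Props.x∙yz≈y∙xz ⌊ z ≟ x ⌋ ⌊ z ≟ y ⌋ (mem z S)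

  mem-here : ∀ (x : Fin m) S → mem x (x ∷ S) ≡ true
  mem-here x S with x ≟ x
  ... | yes _   = refl
  ... | no x≢x = contradiction refl x≢x

  mem-there : ∀ (x : Fin m) y S → mem x S ≡ true → mem x (y ∷ S) ≡ true
  mem-there x y S x∈S rewrite x∈S = ∨-zeroʳ ⌊ x ≟ y ⌋

  mem-∷⁺-false : ∀ {x y : Fin m} S → y ≢ x → mem x S ≡ false → mem x (y ∷ S) ≡ false
  mem-∷⁺-false {x} {y} S y≢x x∉S with x ≟ y
  ... | yes refl = contradiction refl y≢x
  ... | no _     = x∉S

  mem-∷⁻-false : ∀ {x : Fin m} y S → mem x (y ∷ S) ≡ false → mem x S ≡ false
  mem-∷⁻-false {x} y S h with ⌊ x ≟ y ⌋
  ... | false = h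

  firstAvail-available : ∀ (l S : List (Fin m)) {x} → firstAvail l S ≡ just x → mem x S ≡ false
  firstAvail-available (w ∷ l) S h with mem w S in e
  ... | true  = firstAvail-available l S h
  ... | false with refl ← h = e

  firstAvail-nothing : ∀ (l S : List (Fin m)) {z} → firstAvail l S ≡ nothing → z ∈ l → mem z S ≡ true
  firstAvail-nothing (w ∷ l) S h z∈l with mem w S in e | z∈l
  ... | true  | here refl  = e
  ... | true  | there z∈l′ = firstAvail-nothing l S h z∈l′

  firstAvail-≢nothing : ∀ {l S : List (Fin m)} {x} → x ∈ l → mem x S ≡ false →
                        firstAvail l S ≢ nothing
  firstAvail-≢nothing {l} {S} x∈l x∉S h =
    contradiction (trans (sym (firstAvail-nothing l S h x∈l)) x∉S) λ ()

  firstAvail-allTaken : ∀ (l S : List (Fin m)) → (∀ z → mem z S ≡ true) → firstAvail l S ≡ nothing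
  firstAvail-allTaken []      S all = refl
  firstAvail-allTaken (w ∷ l) S all rewrite all w = firstAvail-allTaken l S all

  firstAvail-cong : ∀ (l : List (Fin m)) {S S'} → SameTaken S S' → firstAvail l S ≡ firstAvail l S'
  firstAvail-cong []      eq = refl
  firstAvail-cong (w ∷ l) {S} {S'} eq rewrite mem-≡ eq w with mem w S'
  ... | true  = firstAvail-cong l eq
  ... | false = refl

  firstAvail-∷ : ∀ (l S : List (Fin m)) {x} y → firstAvail l S ≡ just x → y ≢ x →
                 firstAvail l (y ∷ S) ≡ just x
  firstAvail-∷ (w ∷ l) S y h y≢x with mem w S
  ... | true rewrite ∨-zeroʳ ⌊ w ≟ y ⌋ = firstAvail-∷ l S y h y≢x
  ... | false with refl ← h | w ≟ y
  ...   | yes refl = contradiction refl y≢x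
  ...   | no _     = refl

  firstAvail-∷-nothing : ∀ (l S : List (Fin m)) y → firstAvail l S ≡ nothing →
                         firstAvail l (y ∷ S) ≡ nothing
  firstAvail-∷-nothing []      S y h = refl
  firstAvail-∷-nothing (w ∷ l) S y h with mem w S
  ... | true rewrite ∨-zeroʳ ⌊ w ≟ y ⌋ = firstAvail-∷-nothing l S y h

  firstAvail-skipTaken : ∀ (l₁ l₂ S : List (Fin m)) {x} → mem x S ≡ true →
                         firstAvail (l₁ ++ x ∷ l₂) S ≡ firstAvail (l₁ ++ l₂) S
  firstAvail-skipTaken []       l₂ S x∈S rewrite x∈S = refl
  firstAvail-skipTaken (w ∷ l₁) l₂ S x∈S with mem w S
  ... | true  = firstAvail-skipTaken l₁ l₂ S x∈S
  ... | false = refl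

  firstAvail-remove : ∀ (l₁ l₂ S : List (Fin m)) {x y} → mem x S ≡ false →
                      firstAvail (l₁ ++ x ∷ l₂) S ≡ just y → y ≢ x →
                      firstAvail (l₁ ++ l₂) (x ∷ S) ≡ just y
  firstAvail-remove []       l₂ S x∉S h y≢x rewrite x∉S with refl ← h = contradiction refl y≢x
  firstAvail-remove (w ∷ l₁) l₂ S {x} x∉S h y≢x with mem w S
  ... | true rewrite ∨-zeroʳ ⌊ w ≟ x ⌋ = firstAvail-remove l₁ l₂ S x∉S h y≢x
  ... | false with refl ← h | w ≟ x
  ...   | yes refl = contradiction refl y≢x
  ...   | no _     = refl

module _ {m : ℕ} (u : Fin m → ℚ) where

  BestAvailable : List (Fin m) → Fin m → Set
  BestAvailable S x = ∀ z → mem z S ≡ false → u z ≤ℚ u x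

  bestAvailable-∷ : ∀ S {x} y → BestAvailable S x → BestAvailable (y ∷ S) x
  bestAvailable-∷ S y best z z∉yS = best z (mem-∷⁻-false y S z∉yS)

  firstAvail-prefers : ∀ (l S : List (Fin m)) {x z} → firstAvail l S ≡ just x →
                       mem z S ≡ false → z ∈ l → z ≢ x → Prefers l x z
  firstAvail-prefers (w ∷ l) S h z∉S z∈l z≢x with mem w S in e | z∈l
  ... | true  | here refl = contradiction (trans (sym e) z∉S) λ ()
  ... | true  | there z∈l′ with firstAvail-prefers l S h z∉S z∈l′ z≢x
  ...   | i , j , i<j , lᵢ , lⱼ = suc i , suc j , s≤s i<j , lᵢ , lⱼ
  firstAvail-prefers (w ∷ l) S refl z∉S z∈l z≢x | false | here refl = contradiction refl z≢x
  firstAvail-prefers (w ∷ l) S refl z∉S z∈l z≢x | false | there z∈l′ =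
    zero , suc (index z∈l′) , s≤s z≤n , refl , sym (lookup-index z∈l′)

  firstAvail-best : ∀ {r S x} → Consistent r u → (∀ z → z ∈ r) → firstAvail r S ≡ just x →
                    BestAvailable S x
  firstAvail-best {r} {S} {x} consistent complete h z z∉S with z ≟ x
  ... | yes refl = ℚ.≤-refl
  ... | no z≢x   = ℚ.<⇒≤ (consistent x z (firstAvail-prefers r S h z∉S (complete z) z≢x))

  sumU-↭ : ∀ {xs ys} → xs ↭ ys → sumU u xs ≡ sumU u ys
  sumU-↭ ↭.refl                   = refl
  sumU-↭ (↭.prep x p)             = cong (u x +_) (sumU-↭ p)
  sumU-↭ (↭.swap {xs = xs} x y p) =
    trans (+-Props.x∙yz≈y∙xz (u x) (u y) (sumU u xs)) (cong (λ t → u y + (u x + t)) (sumU-↭ p))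
  sumU-↭ (↭.trans p q)            = trans (sumU-↭ p) (sumU-↭ q)

  sumU-++⁺ˡ-≤ : ∀ g {l l′} → sumU u l ≤ℚ sumU u l′ → sumU u (g ++ l) ≤ℚ sumU u (g ++ l′)
  sumU-++⁺ˡ-≤ []      l≤l′ = l≤l′
  sumU-++⁺ˡ-≤ (x ∷ g) l≤l′ = ℚ.+-monoʳ-≤ (u x) (sumU-++⁺ˡ-≤ g l≤l′)

module _ {k m : ℕ} (rk : Agent k → List (Fin m)) where

  run-zero-just : ∀ {s S y} π → firstAvail s S ≡ just y →
                  run rk s (zero ∷ π) S ≡ y ∷ run rk s π (y ∷ S)
  run-zero-just π h rewrite h = refl

  run-zero-nothing : ∀ {s S} π → firstAvail s S ≡ nothing → run rk s (zero ∷ π) S ≡ run rk s π S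
  run-zero-nothing π h rewrite h = refl

  run-suc-just : ∀ {s S a y} π → firstAvail (rk (suc a)) S ≡ just y →
                 run rk s (suc a ∷ π) S ≡ run rk s π (y ∷ S)
  run-suc-just π h rewrite h = refl

  run-suc-nothing : ∀ {s S a} π → firstAvail (rk (suc a)) S ≡ nothing →
                    run rk s (suc a ∷ π) S ≡ run rk s π S
  run-suc-nothing π h rewrite h = refl

  run-cong-taken : ∀ s π {S S'} → SameTaken S S' → run rk s π S ≡ run rk s π S'
  run-cong-taken s []          eq = refl
  run-cong-taken s (zero ∷ π) {S} {S'} eq with firstAvail s S in e
  ... | just y  = begin
    y ∷ run rk s π (y ∷ S)  ≡⟨ cong (y ∷_) (run-cong-taken s π (sameTaken-∷ y eq)) ⟩
    y ∷ run rk s π (y ∷ S') ≡⟨ run-zero-just π (trans (sym (firstAvail-cong s eq)) e) ⟨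
    run rk s (zero ∷ π) S'  ∎
    where open ≡-Reasoning
  ... | nothing = trans (run-cong-taken s π eq)
                        (sym (run-zero-nothing π (trans (sym (firstAvail-cong s eq)) e)))
  run-cong-taken s (suc a ∷ π) {S} {S'} eq with firstAvail (rk (suc a)) S in e
  ... | just y  = trans (run-cong-taken s π (sameTaken-∷ y eq))
                        (sym (run-suc-just π (trans (sym (firstAvail-cong (rk (suc a)) eq)) e)))
  ... | nothing = trans (run-cong-taken s π eq)
                        (sym (run-suc-nothing π (trans (sym (firstAvail-cong (rk (suc a)) eq)) e)))

  run-skipTaken : ∀ l₁ l₂ {x} π S → mem x S ≡ true →
                  run rk (l₁ ++ x ∷ l₂) π S ≡ run rk (l₁ ++ l₂) π S
  run-skipTaken l₁ l₂ []          S x∈S = refl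
  run-skipTaken l₁ l₂ {x} (zero ∷ π) S x∈S
    rewrite firstAvail-skipTaken l₁ l₂ S x∈S with firstAvail (l₁ ++ l₂) S
  ... | just y  = cong (y ∷_) (run-skipTaken l₁ l₂ π (y ∷ S) (mem-there x y S x∈S))
  ... | nothing = run-skipTaken l₁ l₂ π S x∈S
  run-skipTaken l₁ l₂ {x} (suc a ∷ π) S x∈S with firstAvail (rk (suc a)) S
  ... | just y  = run-skipTaken l₁ l₂ π (y ∷ S) (mem-there x y S x∈S)
  ... | nothing = run-skipTaken l₁ l₂ π S x∈S

  run-removed-samePick : ∀ r₁ r₂ {x y} π S → mem x S ≡ false →
                         firstAvail (r₁ ++ x ∷ r₂) S ≡ just y → y ≢ x →
                         run rk (r₁ ++ r₂) (zero ∷ π) (x ∷ S) ≡ y ∷ run rk (r₁ ++ r₂) π (x ∷ y ∷ S)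
  run-removed-samePick r₁ r₂ {x} {y} π S x∉S h y≢x =
    trans (run-zero-just π (firstAvail-remove r₁ r₂ S x∉S h y≢x))
          (cong (y ∷_) (run-cong-taken (r₁ ++ r₂) π (sameTaken-swap y x S)))

  run-moveToFront : ∀ r₁ r₂ {x} n tl S → mem x S ≡ false →
                    x ∈ run rk (r₁ ++ x ∷ r₂) (replicate (suc n) zero) S →
                    run rk (r₁ ++ x ∷ r₂) (replicate (suc n) zero ++ tl) S ↭
                    x ∷ run rk (r₁ ++ r₂) (replicate n zero ++ tl) (x ∷ S)
  run-moveToFront r₁ r₂ {x} n tl S x∉S x∈picks with firstAvail (r₁ ++ x ∷ r₂) S in e
  ... | nothing = contradiction e (firstAvail-≢nothing (∈-++⁺ʳ r₁ (here refl)) x∉S)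
  ... | just y with y ≟ x
  ...   | yes refl =
    ↭-reflexive (cong (x ∷_) (run-skipTaken r₁ r₂ (replicate n zero ++ tl) (x ∷ S) (mem-here x S)))
  ...   | no y≢x with n | x∈picks
  ...     | _      | here x≡y      = contradiction (sym x≡y) y≢x
  ...     | zero   | there ()
  ...     | suc n′ | there x∈later = begin
    y ∷ run rk q (replicate (suc n′) zero ++ tl) (y ∷ S)
      ↭⟨ prep y (run-moveToFront r₁ r₂ n′ tl (y ∷ S) (mem-∷⁺-false S y≢x x∉S) x∈later) ⟩
    y ∷ x ∷ run rk q′ (replicate n′ zero ++ tl) (x ∷ y ∷ S)
      ↭⟨ swap y x ↭-refl ⟩
    x ∷ y ∷ run rk q′ (replicate n′ zero ++ tl) (x ∷ y ∷ S)
      ≡⟨ cong (x ∷_) (run-removed-samePick r₁ r₂ _ S x∉S e y≢x) ⟨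
    x ∷ run rk q′ (replicate (suc n′) zero ++ tl) (x ∷ S)
      ∎
    where
    open PermutationReasoning
    q  = r₁ ++ x ∷ r₂
    q′ = r₁ ++ r₂

  run-delayTurn : ∀ q {a x} n rest S → firstAvail (rk (suc a)) S ≡ just x →
                  x ∉ run rk q (replicate (suc n) zero) S →
                  run rk q (replicate (suc n) zero ++ suc a ∷ rest) S ≡
                  run rk q (replicate n zero ++ suc a ∷ zero ∷ rest) S
  run-delayTurn q {a} {x} zero rest S ha x∉picks with firstAvail q S in e
  ... | just y  = begin
    y ∷ run rk q (suc a ∷ rest) (y ∷ S)
      ≡⟨ cong (y ∷_) (run-suc-just rest (firstAvail-∷ (rk (suc a)) S y ha y≢x)) ⟩
    y ∷ run rk q rest (x ∷ y ∷ S)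
      ≡⟨ cong (y ∷_) (run-cong-taken q rest (sameTaken-swap x y S)) ⟩
    y ∷ run rk q rest (y ∷ x ∷ S)
      ≡⟨ run-zero-just rest (firstAvail-∷ q S x e (λ x≡y → y≢x (sym x≡y))) ⟨
    run rk q (zero ∷ rest) (x ∷ S)
      ≡⟨ run-suc-just (zero ∷ rest) ha ⟨
    run rk q (suc a ∷ zero ∷ rest) S
      ∎
    where
    open ≡-Reasoning
    y≢x : y ≢ x
    y≢x y≡x = x∉picks (here (sym y≡x))
  ... | nothing = trans (run-suc-just rest ha)
    (sym (trans (run-suc-just (zero ∷ rest) ha) (run-zero-nothing rest (firstAvail-∷-nothing q S x e))))
  run-delayTurn q {a} {x} (suc n) rest S ha x∉picks with firstAvail q S in e
  ... | just y  = cong (y ∷_) (run-delayTurn q n rest (y ∷ S) (firstAvail-∷ (rk (suc a)) S y ha y≢x)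
                                              (λ x∈picks → x∉picks (there x∈picks)))
    where
    y≢x : y ≢ x
    y≢x y≡x = x∉picks (here (sym y≡x))
  ... | nothing = run-delayTurn q n rest S ha x∉picks

  module _ (u : Fin m → ℚ) where

    run-moveToFront-best : ∀ r₁ r₂ {x} n S → mem x S ≡ false → BestAvailable u S x →
                           sumU u (run rk (r₁ ++ x ∷ r₂) (replicate (suc n) zero) S) ≤ℚ
                           u x + sumU u (run rk (r₁ ++ r₂) (replicate n zero) (x ∷ S))
    run-moveToFront-best r₁ r₂ {x} n S x∉S best with firstAvail (r₁ ++ x ∷ r₂) S in e
    ... | nothing = contradiction e (firstAvail-≢nothing (∈-++⁺ʳ r₁ (here refl)) x∉S)
    ... | just y with y ≟ x
    ...   | yes refl = ℚ.≤-reflexive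
      (cong (λ t → u x + sumU u t) (run-skipTaken r₁ r₂ (replicate n zero) (x ∷ S) (mem-here x S)))
    ...   | no y≢x with n
    ...     | zero   = ℚ.+-monoˡ-≤ 0ℚ (best y (firstAvail-available (r₁ ++ x ∷ r₂) S e))
    ...     | suc n′ = begin
      u y + sumU u (run rk q (replicate (suc n′) zero) (y ∷ S))
        ≤⟨ ℚ.+-monoʳ-≤ (u y) later ⟩
      u y + (u x + sumU u (run rk q′ (replicate n′ zero) (x ∷ y ∷ S)))
        ≡⟨ +-Props.x∙yz≈y∙xz (u y) (u x) _ ⟩
      u x + (u y + sumU u (run rk q′ (replicate n′ zero) (x ∷ y ∷ S)))
        ≡⟨ cong (λ t → u x + sumU u t) (run-removed-samePick r₁ r₂ _ S x∉S e y≢x) ⟨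
      u x + sumU u (run rk q′ (replicate (suc n′) zero) (x ∷ S))
        ∎
      where
      open ℚ.≤-Reasoning
      q  = r₁ ++ x ∷ r₂
      q′ = r₁ ++ r₂
      later = run-moveToFront-best r₁ r₂ n′ (y ∷ S) (mem-∷⁺-false S y≢x x∉S) (bestAvailable-∷ u S y best)

module _ {k : ℕ} where

  targetAgent : List (Agent k) → Agent k
  targetAgent π with core π
  ... | []    = zero
  ... | a ∷ _ = a

  core-replicate : ∀ n → core {k} (replicate n zero) ≡ []
  core-replicate zero    = refl
  core-replicate (suc n) = core-replicate n

  core-replicate-++ : ∀ n (π : List (Agent k)) → core (replicate n zero ++ π) ≡ core π
  core-replicate-++ zero    π = refl
  core-replicate-++ (suc n) π = core-replicate-++ n π

  targetAgent-replicate : ∀ n → targetAgent (replicate n zero) ≡ zero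
  targetAgent-replicate n rewrite core-replicate n = refl

  targetAgent-next : ∀ n a (π : List (Agent k)) → targetAgent (replicate n zero ++ suc a ∷ π) ≡ suc a
  targetAgent-next n a π rewrite core-replicate-++ n (suc a ∷ π) = refl

  data Upcoming : List (Agent k) → Set where
    only-manipulator : ∀ n → Upcoming (replicate n zero)
    manipulator-then : ∀ n a π → Upcoming (replicate n zero ++ suc a ∷ π)

  upcoming : ∀ π → Upcoming π
  upcoming []          = only-manipulator 0
  upcoming (suc a ∷ π) = manipulator-then 0 a π
  upcoming (zero ∷ π) with upcoming π
  ... | only-manipulator n     = only-manipulator (suc n)
  ... | manipulator-then n a ρ = manipulator-then (suc n) a ρ

  replicate-shift : ∀ n (π : List (Agent k)) →
                    zero ∷ replicate n zero ++ π ≡ replicate n zero ++ zero ∷ π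
  replicate-shift zero    π = refl
  replicate-shift (suc n) π = cong (zero ∷_) (replicate-shift n π)

  ++-replicate-shift : ∀ pre n (π : List (Agent k)) →
                       pre ++ zero ∷ replicate n zero ++ π ≡ (pre ++ replicate n zero) ++ zero ∷ π
  ++-replicate-shift pre n π =
    trans (cong (pre ++_) (replicate-shift n π)) (sym (++-assoc pre _ (zero ∷ π)))

  core-swap : ∀ (p : List (Agent k)) a π →
              core (p ++ zero ∷ suc a ∷ π) ≡ core (p ++ suc a ∷ zero ∷ π)
  core-swap []          a π = refl
  core-swap (zero ∷ p)  a π = core-swap p a π
  core-swap (suc b ∷ p) a π = cong (suc b ∷_) (core-swap p a π)

  positionsFrom-swap : ∀ i (p : List (Agent k)) a π →
                       Pointwise _≤ℕ_ (positionsFrom i (p ++ zero ∷ suc a ∷ π))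
                                      (positionsFrom i (p ++ suc a ∷ zero ∷ π))
  positionsFrom-swap i []          a π = n≤1+n i ∷ Pointwise.refl ≤ℕ-refl
  positionsFrom-swap i (zero ∷ p)  a π = ≤ℕ-refl ∷ positionsFrom-swap (suc i) p a π
  positionsFrom-swap i (suc b ∷ p) a π = positionsFrom-swap (suc i) p a π

  swapped-policy : ∀ {m} (π : Vec (Agent k) m) p a ρ → toList π ≡ p ++ zero ∷ suc a ∷ ρ →
                   Σ (Vec (Agent k) m) λ π′ → toList π′ ≡ p ++ suc a ∷ zero ∷ ρ
  swapped-policy {m} π p a ρ eπ = vectorOf (p ++ suc a ∷ zero ∷ ρ) (begin
    length (p ++ suc a ∷ zero ∷ ρ) ≡⟨ ↭-length (++⁺ˡ p (swap (suc a) zero ↭-refl)) ⟩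
    length (p ++ zero ∷ suc a ∷ ρ) ≡⟨ cong length eπ ⟨
    length (toList π)              ≡⟨ length-toList π ⟩
    m                              ∎)
    where open ≡-Reasoning

  module _ {m} {π π′ : Vec (Agent k) m} p a ρ (eπ : toList π ≡ p ++ zero ∷ suc a ∷ ρ)
           (eπ′ : toList π′ ≡ p ++ suc a ∷ zero ∷ ρ) where

    swap-≢ : π′ ≢ π
    swap-≢ π′≡π
      with ∷-injectiveˡ (++-cancelˡ p _ _ (trans (sym eπ′) (trans (cong toList π′≡π) eπ)))
    ... | ()

    swap-dominates : Dominates π π′
    swap-dominates = trans (cong core eπ) (trans (core-swap p a ρ) (cong core (sym eπ′))) , earlier
      where
      earlier : Pointwise _≤ℕ_ (positions (toList π)) (positions (toList π′))
      earlier rewrite eπ | eπ′ = positionsFrom-swap 0 p a ρ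

module _ {m : ℕ} where

  open import Data.List.Membership.DecPropositional (_≟_ {m}) using (_∈?_)

  _↭?_ : (xs ys : List (Fin m)) → Dec (xs ↭ ys)
  []       ↭? []      = yes ↭-refl
  []       ↭? (y ∷ ys) = no λ p → case ↭-empty-inv (↭-sym p) of λ ()
  (x ∷ xs) ↭? ys with x ∈? ys
  ... | no x∉ys = no λ p → x∉ys (∈-resp-↭ p (here refl))
  ... | yes x∈ys with ∈-∃++ x∈ys
  ...   | ys₁ , ys₂ , refl with xs ↭? (ys₁ ++ ys₂)
  ...     | yes p = yes (↭-trans (prep x p) (↭-sym (shift x ys₁ ys₂)))
  ...     | no ¬p = no λ p → ¬p (drop-mid [] ys₁ p)

  listsOfLength : ℕ → List (List (Fin m))
  listsOfLength zero    = [ [] ]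
  listsOfLength (suc n) = cartesianProductWith _∷_ (allFin m) (listsOfLength n)

  ∈-listsOfLength : ∀ l → l ∈ listsOfLength (length l)
  ∈-listsOfLength []      = here refl
  ∈-listsOfLength (x ∷ l) = ∈-cartesianProductWith⁺ _∷_ (∈-allFin x) (∈-listsOfLength l)

  strategies : List (List (Fin m))
  strategies = filter (_↭? allFin m) (listsOfLength m)

  ∈-strategies : ∀ {s} → IsStrategy s → s ∈ strategies
  ∈-strategies {s} s↭ = ∈-filter⁺ (_↭? allFin m) s∈ s↭
    where
    s∈ : s ∈ listsOfLength m
    s∈ = subst (λ n → s ∈ listsOfLength n) (trans (↭-length s↭) (length-tabulate {n = m} id))
               (∈-listsOfLength s)

available-∈-rest : ∀ {m} {g r T : List (Fin m)} {x} → IsStrategy (g ++ r) →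
                   (∀ z → z ∈ g → mem z T ≡ true) → mem x T ≡ false → x ∈ r
available-∈-rest {g = g} {x = x} strategy g-taken x∉T
  with ∈-++⁻ g (∈-resp-↭ (↭-sym strategy) (∈-allFin x))
... | inj₁ x∈g = contradiction (trans (sym (g-taken x x∈g)) x∉T) λ ()
... | inj₂ x∈r = x∈r

optimal-exists : ∀ {k m} (rk : Agent k → List (Fin m)) u π → ∃ (Optimal rk u π)
optimal-exists {m = m} rk u π =
  best , argmax-all util (↭-refl {x = allFin m}) (all-filter (_↭? allFin m) (listsOfLength m)) ,
  λ s s↭ → All.lookup (f[xs]≤f[argmax] (allFin m) strategies) (∈-strategies s↭)
  where
  util = utility rk u π
  best = argmax util (allFin m) strategies

crucial-no-tie : ∀ {k m} {rk : Agent k → List (Fin m)} {u π π′ s} → Crucial rk u π →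
                 Optimal rk u π s → π′ ≢ π → Dominates π π′ → utility rk u π′ s ≢ utility rk u π s
crucial-no-tie crucial (s-strategy , s-best) π′≢π dom tie
  with s′ , s′-strategy , worse ← crucial _ π′≢π dom _ s-strategy =
  ℚ.<-irrefl refl (ℚ.<-≤-trans (subst (_<ℚ _) tie worse) (s-best s′ s′-strategy))

module _ {k m : ℕ} (rk : Agent k → List (Fin m)) where

  greedyFrom-zero-just : ∀ suf T {x} → firstAvail (rk (targetAgent suf)) T ≡ just x →
                         greedyFrom rk (zero ∷ suf) T ≡ x ∷ greedyFrom rk suf (x ∷ T)
  greedyFrom-zero-just suf T h with core suf
  ... | []    rewrite h = refl
  ... | a ∷ _ rewrite h = refl

  greedyFrom-zero-nothing : ∀ suf T → firstAvail (rk (targetAgent suf)) T ≡ nothing →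
                            greedyFrom rk (zero ∷ suf) T ≡ greedyFrom rk suf T
  greedyFrom-zero-nothing suf T h with core suf
  ... | []    rewrite h = refl
  ... | a ∷ _ rewrite h = refl

  record Reached (pre : List (Agent k)) (g T : List (Fin m)) : Set where
    field
      run-prefix  : ∀ r tl → run rk (g ++ r) (pre ++ tl) [] ≡ g ++ run rk r tl T
      picks-taken : ∀ z → z ∈ g → mem z T ≡ true
  open Reached

  reached-start : Reached [] [] []
  reached-start = record { run-prefix = λ r tl → refl ; picks-taken = λ z () }

  reached-step : ∀ {pre g T T′} b → Reached pre g T →
                 (∀ r tl → run rk r (b ∷ tl) T ≡ run rk r tl T′) →
                 (∀ z → mem z T ≡ true → mem z T′ ≡ true) → Reached (pre ++ [ b ]) g T′
  reached-step {pre} {g} {T} {T′} b reached turn grows = record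
    { run-prefix  = λ r tl → begin
        run rk (g ++ r) ((pre ++ [ b ]) ++ tl) []
          ≡⟨ cong (λ π → run rk (g ++ r) π []) (++-assoc pre [ b ] tl) ⟩
        run rk (g ++ r) (pre ++ b ∷ tl) []
          ≡⟨ run-prefix reached r (b ∷ tl) ⟩
        g ++ run rk r (b ∷ tl) T
          ≡⟨ cong (g ++_) (turn r tl) ⟩
        g ++ run rk r tl T′
          ∎
    ; picks-taken = λ z z∈g → grows z (picks-taken reached z z∈g)
    }
    where open ≡-Reasoning

  reached-pick : ∀ {pre g T x} → Reached pre g T → mem x T ≡ false →
                 Reached (pre ++ [ zero ]) (g ++ [ x ]) (x ∷ T)
  reached-pick {pre} {g} {T} {x} reached x∉T = record
    { run-prefix  = λ r tl → begin
        run rk ((g ++ [ x ]) ++ r) ((pre ++ [ zero ]) ++ tl) []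
          ≡⟨ cong₂ (λ s π → run rk s π []) (++-assoc g [ x ] r) (++-assoc pre [ zero ] tl) ⟩
        run rk (g ++ x ∷ r) (pre ++ zero ∷ tl) []
          ≡⟨ run-prefix reached (x ∷ r) (zero ∷ tl) ⟩
        g ++ run rk (x ∷ r) (zero ∷ tl) T
          ≡⟨ cong (g ++_) (run-zero-just rk tl (x-first {r})) ⟩
        g ++ x ∷ run rk (x ∷ r) tl (x ∷ T)
          ≡⟨ cong (λ t → g ++ x ∷ t) (run-skipTaken rk [] r tl (x ∷ T) (mem-here x T)) ⟩
        g ++ x ∷ run rk r tl (x ∷ T)
          ≡⟨ ++-assoc g [ x ] _ ⟨
        (g ++ [ x ]) ++ run rk r tl (x ∷ T)
          ∎
    ; picks-taken = picked
    }
    where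
    open ≡-Reasoning
    x-first : ∀ {r} → firstAvail (x ∷ r) T ≡ just x
    x-first rewrite x∉T = refl
    picked : ∀ z → z ∈ g ++ [ x ] → mem z (x ∷ T) ≡ true
    picked z z∈ with ∈-++⁻ g z∈
    ... | inj₁ z∈g         = mem-there z x T (picks-taken reached z z∈g)
    ... | inj₂ (here refl) = mem-here z T

module Greedy {k m : ℕ} (rk : Agent k → List (Fin m)) (complete : ∀ b z → z ∈ rk b)
         (u : Fin m → ℚ) (consistent : Consistent (rk zero) u)
         (π : Vec (Agent k) m) (crucial : Crucial rk u π) where

  open import Data.List.Membership.DecPropositional (_≟_ {m}) using (_∈?_)

  Settled : List (Fin m) → Set
  Settled P = (∃ λ r → Optimal rk u π (P ++ r)) × (∀ q → run rk (P ++ q) (toList π) [] ≡ P)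

  utility-after : ∀ {π′ pre g T} q tl → Reached rk pre g T → toList π′ ≡ pre ++ tl →
                  utility rk u π′ (g ++ q) ≡ sumU u (g ++ run rk q tl T)
  utility-after {g = g} q tl reached eπ′ =
    trans (cong (λ ρ → sumU u (run rk (g ++ q) ρ [])) eπ′)
          (cong (sumU u) (Reached.run-prefix reached q tl))

  -- If x were not picked, delaying this manipulator turn behind a's would leave all picks
  -- unchanged, and the delayed policy is dominated by π.
  crucial-forces-pick : ∀ {pre g T q x} n a ρ → toList π ≡ pre ++ zero ∷ replicate n zero ++ suc a ∷ ρ →
                        Reached rk pre g T → Optimal rk u π (g ++ q) → firstAvail (rk (suc a)) T ≡ just x →
                        x ∈ run rk q (replicate (suc n) zero) T
  crucial-forces-pick {pre} {g} {T} {q} {x} n a ρ eπ reached opt ha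
    with x ∈? run rk q (replicate (suc n) zero) T
  ... | yes picked  = picked
  ... | no unpicked = contradiction same-utility
    (crucial-no-tie crucial opt (swap-≢ p a ρ shifted eπ′) (swap-dominates p a ρ shifted eπ′))
    where
    open ≡-Reasoning
    p = pre ++ replicate n zero
    shifted = trans eπ (++-replicate-shift pre n (suc a ∷ ρ))
    π′  = proj₁ (swapped-policy π p a ρ shifted)
    eπ′ = proj₂ (swapped-policy π p a ρ shifted)
    same-utility : utility rk u π′ (g ++ q) ≡ utility rk u π (g ++ q)
    same-utility = begin
      utility rk u π′ (g ++ q)
        ≡⟨ utility-after q _ reached (trans eπ′ (++-assoc pre _ _)) ⟩
      sumU u (g ++ run rk q (replicate n zero ++ suc a ∷ zero ∷ ρ) T)
        ≡⟨ cong (λ t → sumU u (g ++ t)) (run-delayTurn rk q n ρ T ha unpicked) ⟨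
      sumU u (g ++ run rk q (zero ∷ replicate n zero ++ suc a ∷ ρ) T)
        ≡⟨ utility-after q _ reached eπ ⟨
      utility rk u π (g ++ q)
        ∎

  moveToFront-gain : ∀ {pre g T x} suf r₁ r₂ → toList π ≡ pre ++ zero ∷ suf → Reached rk pre g T →
                     firstAvail (rk (targetAgent suf)) T ≡ just x → Optimal rk u π (g ++ r₁ ++ x ∷ r₂) →
                     sumU u (run rk (r₁ ++ x ∷ r₂) (zero ∷ suf) T) ≤ℚ
                     u x + sumU u (run rk (r₁ ++ r₂) suf (x ∷ T))
  moveToFront-gain {T = T} {x} suf r₁ r₂ eπ reached h opt with upcoming suf
  ... | only-manipulator n =
    run-moveToFront-best rk u r₁ r₂ n T x∉T (firstAvail-best u consistent (complete zero) h₀)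
    where
    h₀ = subst (λ b → firstAvail (rk b) T ≡ just x) (targetAgent-replicate n) h
    x∉T = firstAvail-available (rk zero) T h₀
  ... | manipulator-then n a ρ = ℚ.≤-reflexive (sumU-↭ u
    (run-moveToFront rk r₁ r₂ n (suc a ∷ ρ) T x∉T (crucial-forces-pick n a ρ eπ reached opt hₐ)))
    where
    hₐ = subst (λ b → firstAvail (rk b) T ≡ just x) (targetAgent-next n a ρ) h
    x∉T = firstAvail-available (rk (suc a)) T hₐ

  exchange : ∀ {pre g T x} suf → toList π ≡ pre ++ zero ∷ suf → Reached rk pre g T →
             firstAvail (rk (targetAgent suf)) T ≡ just x →
             ∃ (λ r → Optimal rk u π (g ++ r)) → ∃ λ r′ → Optimal rk u π ((g ++ [ x ]) ++ r′)
  exchange {pre} {g} {T} {x} suf eπ reached h (r , r-strategy , r-best)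
    with ∈-∃++ (available-∈-rest {T = T} {x} r-strategy (Reached.picks-taken reached)
                                 (firstAvail-available (rk (targetAgent suf)) T h))
  ... | r₁ , r₂ , refl = r₁ ++ r₂ , strategy′ , λ s s-strategy → ℚ.≤-trans (r-best s s-strategy) gain
    where
    x∉T = firstAvail-available (rk (targetAgent suf)) T h
    strategy′ : IsStrategy ((g ++ [ x ]) ++ r₁ ++ r₂)
    strategy′ = ↭-trans (↭-reflexive (++-assoc g [ x ] _))
                        (↭-trans (++⁺ˡ g (↭-sym (shift x r₁ r₂))) r-strategy)
    gain : utility rk u π (g ++ r₁ ++ x ∷ r₂) ≤ℚ utility rk u π ((g ++ [ x ]) ++ r₁ ++ r₂)
    gain = begin
      utility rk u π (g ++ r₁ ++ x ∷ r₂)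
        ≡⟨ utility-after _ _ reached eπ ⟩
      sumU u (g ++ run rk (r₁ ++ x ∷ r₂) (zero ∷ suf) T)
        ≤⟨ sumU-++⁺ˡ-≤ u g (moveToFront-gain suf r₁ r₂ eπ reached h (r-strategy , r-best)) ⟩
      sumU u (g ++ x ∷ run rk (r₁ ++ r₂) suf (x ∷ T))
        ≡⟨ cong (sumU u) (++-assoc g [ x ] _) ⟨
      sumU u ((g ++ [ x ]) ++ run rk (r₁ ++ r₂) suf (x ∷ T))
        ≡⟨ utility-after _ _ (reached-pick rk reached x∉T) (advance eπ) ⟨
      utility rk u π ((g ++ [ x ]) ++ r₁ ++ r₂)
        ∎
      where open ℚ.≤-Reasoning

  settled-optimal : ∀ {P rest} → Settled P → IsStrategy (P ++ rest) → Optimal rk u π (P ++ rest)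
  settled-optimal {P} {rest} ((r , _ , r-best) , fixed) strategy =
    strategy , λ s s-strategy → ℚ.≤-trans (r-best s s-strategy) (ℚ.≤-reflexive same-picks)
    where
    same-picks : utility rk u π (P ++ r) ≡ utility rk u π (P ++ rest)
    same-picks = cong (sumU u) (trans (fixed r) (sym (fixed rest)))

  greedyFrom-settled : ∀ pre suf {g T} → toList π ≡ pre ++ suf → Reached rk pre g T →
                       ∃ (λ r → Optimal rk u π (g ++ r)) → Settled (g ++ greedyFrom rk suf T)
  greedyFrom-settled pre [] {g} eπ reached optimal = subst Settled (sym (++-identityʳ g))
    (optimal , λ q → trans (cong (λ ρ → run rk (g ++ q) ρ []) eπ)
                           (trans (Reached.run-prefix reached q []) (++-identityʳ g)))
  greedyFrom-settled pre (suc a ∷ suf) {g} {T} eπ reached optimal with firstAvail (rk (suc a)) T in e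
  ... | just y  = greedyFrom-settled (pre ++ [ suc a ]) suf (advance eπ)
    (reached-step rk (suc a) reached (λ r tl → run-suc-just rk tl e) (λ z → mem-there z y T)) optimal
  ... | nothing = greedyFrom-settled (pre ++ [ suc a ]) suf (advance eπ)
    (reached-step rk (suc a) reached (λ r tl → run-suc-nothing rk tl e) (λ z → id)) optimal
  greedyFrom-settled pre (zero ∷ suf) {g} {T} eπ reached optimal
    with firstAvail (rk (targetAgent suf)) T in e
  ... | just x rewrite greedyFrom-zero-just rk suf T e = subst Settled (++-assoc g [ x ] _)
    (greedyFrom-settled (pre ++ [ zero ]) suf (advance eπ)
      (reached-pick rk reached (firstAvail-available (rk (targetAgent suf)) T e))
      (exchange suf eπ reached e optimal))
  ... | nothing rewrite greedyFrom-zero-nothing rk suf T e =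
    greedyFrom-settled (pre ++ [ zero ]) suf (advance eπ)
      (reached-step rk zero reached (λ r tl → run-zero-nothing rk tl (firstAvail-allTaken r T all-taken))
                    (λ z → id))
      optimal
    where
    all-taken : ∀ z → mem z T ≡ true
    all-taken z = firstAvail-nothing (rk (targetAgent suf)) T e (complete _ z)

  greedyPicks-settled : Settled (greedyPicks rk π)
  greedyPicks-settled =
    greedyFrom-settled [] (toList π) refl (reached-start rk) (optimal-exists rk u π)

lemma4 : ∀ {k m : ℕ} (rk : Agent k → List (Fin m)) → (∀ a → IsRanking (rk a)) →
    (u : Fin m → ℚ) → Consistent (rk zero) u →
    (π : Vec (Agent k) m) → Crucial rk u π →
    (s : List (Fin m)) → IsStrategy s →
    (∃ λ rest → s ≡ greedyPicks rk π ++ rest) →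
    Optimal rk u π s
lemma4 rk ranking u consistent π crucial s s-strategy (rest , refl) =
  settled-optimal greedyPicks-settled s-strategy
  where
  complete : ∀ b z → z ∈ rk b
  complete b z = ∈-resp-↭ (↭-sym (ranking b)) (∈-allFin z)
  open Greedy rk complete u consistent π crucial
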